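{- Let $n\ge 0$ and define $F_n:\mathcal{A}_{n+1}\to\mathcal{B}_n$ by $F_n(\sigma)=\widetilde{\sigma}$, where for $1\le i\le n$ \[\widetilde{\sigma}_i=\begin{cases}\sigma_{i+1}-\sigma_1 & \text{if } \sigma_{i+1}<\sigma_1,\\ \sigma_{i+1}-1 & \text{if } \sigma_{i+1}>\sigma_1,\end{cases}\] $\widetilde{\sigma}_{ -i}=-\widetilde{\sigma}_i$ and $\widetilde{\sigma}_0=0$. Then for $0\le j,k\le n$, $F_n$ maps $\mathcal{A}_{n+1,k}$ into $\mathcal{B}_{n,k}$, and $F_n$ restricted to $\mathcal{A}_{n+1,k,j+1}$ is a bijection onto $\mathcal{B}_{n,k,\{1,\ldots,j\}}$. Consequently $b(n,k,j)=|\mathcal{A}_{n+1,k,j+1}|$.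
   Context: $\mathcal{A}_m$ is the set of permutations of $\{1,\ldots,m\}$, identified with sequences $(\sigma_1,\ldots,\sigma_m)$; the number of descents of such a sequence is the number of $i$ with $\sigma_i>\sigma_{i+1}$. $\mathcal{A}_{m,k}$ is the set of $\sigma\in\mathcal{A}_m$ with $k$ descents, and $\mathcal{A}_{m,k,j}=\{\sigma\in\mathcal{A}_{m,k}:\sigma_1=j\}$. $\mathcal{B}_n$ is the set of signed permutations of order $n$: bijections $\sigma$ of $\{ -n,\ldots,n\}$ with $\sigma(-i)=-\sigma(i)$, identified with $(0,\sigma_1,\ldots,\sigma_n)$; $\mathrm{des}(\sigma)$ is the number of $i\in\{1,\ldots,n\}$ with $\sigma_{i-1}>\sigma_i$ ($\sigma_0=0$). $\mathcal{B}_{n,k}=\{\sigma\in\mathcal{B}_n:\mathrm{des}(\sigma)=k\}$. For $U\subseteq\{1,\ldots,n\}$, $\mathcal{B}_{n,k,U}$ is the set of $\sigma\in\mathcal{B}_{n,k}$ such that for each $1\le i\le n$, $\sigma_i<0$ iff $|\sigma_i|\in U$. $b(n,k,j):=|\mathcal{B}_{n,k,\{1,\ldots,j\}}|$. -}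

module Defs where

open import Data.Nat as ℕ using (ℕ; zero; suc; _≤_; _∸_)
import Data.Nat.Properties as ℕP
open import Data.Integer as ℤ using (ℤ; +_; -[1+_]; ∣_∣; 0ℤ)
import Data.Integer.Properties as ℤP
open import Data.Vec using (Vec; []; _∷_; toList; map)
open import Data.List as L using (List; []; _∷_; length; filter; upTo; concatMap; _++_)
open import Data.List.Relation.Unary.All using (All; all?)
open import Data.List.Relation.Unary.Unique.Propositional using (Unique)
import Data.List.Relation.Unary.Unique.DecPropositional as UDℕ
import Data.List.Relation.Unary.Unique.DecPropositional as UDℤ
open import Data.Product using (_×_; _,_; proj₁; proj₂)
open import Data.Product.Properties using ()
open import Function.Bundles using (_⇔_; mk⇔; Equivalence)
open import Relation.Nullary using (Dec; yes; no; does; ¬_)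
open import Relation.Nullary.Decidable using (_×-dec_)
open import Relation.Binary.PropositionalEquality using (_≡_)
open import Data.Bool using (Bool; if_then_else_)

desℕ : List ℕ → ℕ
desℕ []           = 0
desℕ (x ∷ [])     = 0
desℕ (x ∷ y ∷ xs) = (if does (y ℕP.<? x) then 1 else 0) ℕ.+ desℕ (y ∷ xs)

desℤ : List ℤ → ℕ
desℤ []           = 0
desℤ (x ∷ [])     = 0
desℤ (x ∷ y ∷ xs) = (if does (y ℤP.<? x) then 1 else 0) ℕ.+ desℤ (y ∷ xs)

IsPerm : (m : ℕ) → Vec ℕ m → Set
IsPerm m σ = All (λ x → 1 ≤ x × x ≤ m) (toList σ) × Unique (toList σ)

InA : (m k : ℕ) → Vec ℕ m → Set
InA m k σ = IsPerm m σ × desℕ (toList σ) ≡ k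

first : {m : ℕ} → Vec ℕ (suc m) → ℕ
first (x ∷ _) = x

InAj : (m k j : ℕ) → Vec ℕ (suc m) → Set
InAj m k j σ = InA (suc m) k σ × first σ ≡ j

-- ℬ_n : signed permutations of order n, identified with (0,σ₁,…,σ_n);
-- σ is determined by (σ₁,…,σ_n) ∈ Vec ℤ n, where (|σ₁|,…,|σ_n|) is a
-- permutation of {1,…,n}, and σ(-i) = -σ(i), σ(0) = 0.

IsSignedPerm : (n : ℕ) → Vec ℤ n → Set
IsSignedPerm n τ =
  All (λ x → 1 ≤ ∣ x ∣ × ∣ x ∣ ≤ n) (toList τ) × Unique (L.map ∣_∣ (toList τ))

desB : {n : ℕ} → Vec ℤ n → ℕ
desB τ = desℤ (0ℤ ∷ toList τ)

InB : (n k : ℕ) → Vec ℤ n → Set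
InB n k τ = IsSignedPerm n τ × desB τ ≡ k

InU : ℕ → ℕ → Set
InU j a = 1 ≤ a × a ≤ j

InBU : (n k j : ℕ) → Vec ℤ n → Set
InBU n k j τ = InB n k τ × All (λ x → (x ℤ.< 0ℤ) ⇔ InU j ∣ x ∣) (toList τ)

shift : ℕ → ℕ → ℤ
shift s x = if does (x ℕP.<? s) then (+ x) ℤ.- (+ s) else + (x ∸ 1)

F : (n : ℕ) → Vec ℕ (suc n) → Vec ℤ n
F n (s ∷ rest) = map (shift s) rest

vecsOver : {A : Set} → List A → (n : ℕ) → List (Vec A n)
vecsOver xs zero    = [] ∷ []
vecsOver xs (suc n) = concatMap (λ x → L.map (x ∷_) (vecsOver xs n)) xs

private
  _⇔?_ : {P Q : Set} → Dec P → Dec Q → Dec (P ⇔ Q)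
  yes p ⇔? yes q = yes (mk⇔ (λ _ → q) (λ _ → p))
  yes p ⇔? no ¬q = no (λ e → ¬q (Equivalence.to e p))
  no ¬p ⇔? yes q = no (λ e → ¬p (Equivalence.from e q))
  no ¬p ⇔? no ¬q = yes (mk⇔ (λ p → Data.Empty.⊥-elim (¬p p)) (λ q → Data.Empty.⊥-elim (¬q q)))
    where import Data.Empty

  InU? : ∀ j a → Dec (InU j a)
  InU? j a = (1 ℕP.≤? a) ×-dec (a ℕP.≤? j)

  InAj? : ∀ m k j (σ : Vec ℕ (suc m)) → Dec (InAj m k j σ)
  InAj? m k j σ =
    (((all? (λ x → (1 ℕP.≤? x) ×-dec (x ℕP.≤? suc m)) (toList σ))
       ×-dec UDℕ.unique? ℕP._≟_ (toList σ))
     ×-dec (desℕ (toList σ) ℕP.≟ k))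
    ×-dec (first σ ℕP.≟ j)

  InBU? : ∀ n k j (τ : Vec ℤ n) → Dec (InBU n k j τ)
  InBU? n k j τ =
    (((all? (λ x → (1 ℕP.≤? ∣ x ∣) ×-dec (∣ x ∣ ℕP.≤? n)) (toList τ))
       ×-dec UDℕ.unique? ℕP._≟_ (L.map ∣_∣ (toList τ)))
     ×-dec (desB τ ℕP.≟ k))
    ×-dec all? (λ x → (x ℤP.<? 0ℤ) ⇔? InU? j ∣ x ∣) (toList τ)

intRange : ℕ → List ℤ
intRange n = L.map +_ (upTo (suc n)) ++ L.map -[1+_] (upTo n)

aCount : (m k j : ℕ) → ℕ
aCount m k j = length (filter (InAj? m k j) (vecsOver (L.map suc (upTo (suc m))) (suc m)))

b : (n k j : ℕ) → ℕ
b n k j = length (filter (InBU? n k j) (vecsOver (intRange n) n))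

-- Fix the first letter s of σ ∈ 𝒜_{n+1}. On the remaining values {1,…,n+1} ∖ {s}
-- the map x ↦ x − s (x < s), x ↦ x − 1 (x > s) is strictly increasing, so F_n keeps
-- every comparison of consecutive letters; the comparison with σ₀ = 0 matches that
-- with σ₁ = s because exactly the values below s become negative. Hence F_n preserves
-- descents. For s = j + 1 the negative letters are precisely those of absolute value
-- ≤ j, and the map has the explicit inverse t ↦ t + 1 (t ≥ 0), t ↦ s + t (t < 0).
module Submission where

open import Defs
open import Data.Nat using (ℕ; suc; _≤_)
open import Data.Vec using (Vec)
open import Data.Integer using (ℤ)
open import Data.Product using (_×_; Σ)
open import Relation.Binary.PropositionalEquality using (_≡_)

open import Data.Nat as ℕ using (zero; _<_; _∸_; z≤n; s≤s; _<?_)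
import Data.Nat.Properties as ℕP
open import Data.Integer as ℤ using (+_; -[1+_]; ∣_∣; 0ℤ; -<-; -<+; +<+)
import Data.Integer.Properties as ℤP
open import Data.Vec as V using ([]; _∷_; toList)
import Data.Vec.Properties as VP
open import Data.List as L using (List; []; _∷_; filter; length; upTo; concatMap; cartesianProductWith)
import Data.List.Properties as LP
open import Data.List.Relation.Unary.All as All using (All; []; _∷_)
import Data.List.Relation.Unary.All.Properties as AllP
open import Data.List.Relation.Unary.Any using (here)
open import Data.List.Relation.Unary.Unique.Propositional using (Unique)
open import Data.List.Relation.Unary.AllPairs using ([]; _∷_)
import Data.List.Relation.Unary.Unique.Propositional.Properties as UniqueP
open import Data.List.Membership.Propositional using (_∈_)
import Data.List.Membership.Propositional.Properties as ∈P
open import Data.List.Membership.Propositional.Properties.WithK using (unique∧set⇒bag)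
open import Data.List.Relation.Binary.BagAndSetEquality using (∼bag⇒↭)
open import Data.List.Relation.Binary.Permutation.Propositional.Properties using (↭-length)
open import Data.Product using (_,_; proj₁; proj₂)
open import Data.Sum using (_⊎_; inj₁; inj₂)
open import Data.Empty using (⊥; ⊥-elim)
open import Data.Bool using (if_then_else_)
open import Function.Bundles using (_⇔_; mk⇔; Equivalence)
open import Relation.Nullary using (does; yes; no)
open import Relation.Nullary.Decidable using (dec-true; dec-false; does-⇔)
open import Relation.Unary using (Decidable)
open import Relation.Binary.PropositionalEquality using (refl; sym; trans; cong; cong₂; subst; _≢_; module ≡-Reasoning)
open import Relation.Binary.Definitions using (tri<; tri≈; tri>)

module _ {A B : Set} where

  Unique-map⁺-on : {P : A → Set} (f : A → B) →
    (∀ {x y} → P x → P y → f x ≡ f y → x ≡ y) →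
    ∀ {xs} → All P xs → Unique xs → Unique (L.map f xs)
  Unique-map⁺-on     f f-inj {[]}     []         []           = []
  Unique-map⁺-on {P} f f-inj {x ∷ xs} (px ∷ pxs) (x∉xs ∷ uxs) =
    fx∉fxs pxs x∉xs ∷ Unique-map⁺-on f f-inj pxs uxs
    where
    fx∉fxs : ∀ {ys} → All P ys → All (x ≢_) ys → All (f x ≢_) (L.map f ys)
    fx∉fxs []         []           = []
    fx∉fxs (py ∷ pys) (x≢y ∷ x∉ys) = (λ fx≡fy → x≢y (f-inj px py fx≡fy)) ∷ fx∉fxs pys x∉ys

  length-filter-bijection : {P : A → Set} {Q : B → Set} (P? : Decidable P) (Q? : Decidable Q)
    (xs : List A) (ys : List B) → Unique xs → Unique ys →
    (f : A → B) → (∀ {x y} → P x → P y → f x ≡ f y → x ≡ y) → (∀ {x} → P x → Q (f x)) →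
    (∀ {y} → Q y → Σ A (λ x → P x × f x ≡ y)) →
    (∀ {x} → P x → x ∈ xs) → (∀ {y} → Q y → y ∈ ys) →
    length (filter Q? ys) ≡ length (filter P? xs)
  length-filter-bijection P? Q? xs ys uxs uys f f-inj f-into f-onto P⊆xs Q⊆ys = begin
    length (filter Q? ys)             ≡⟨ ↭-length (∼bag⇒↭ (unique∧set⇒bag uQ uPf (mk⇔ into onto))) ⟩
    length (L.map f (filter P? xs))   ≡⟨ LP.length-map f (filter P? xs) ⟩
    length (filter P? xs)             ∎
    where
    open ≡-Reasoning
    uQ  = UniqueP.filter⁺ Q? uys
    uPf = Unique-map⁺-on f f-inj (AllP.all-filter P? xs) (UniqueP.filter⁺ P? uxs)
    into : ∀ {y} → y ∈ filter Q? ys → y ∈ L.map f (filter P? xs)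
    into y∈ with f-onto (proj₂ (∈P.∈-filter⁻ Q? {xs = ys} y∈))
    ... | x , px , refl = ∈P.∈-map⁺ f (∈P.∈-filter⁺ P? (P⊆xs px) px)
    onto : ∀ {y} → y ∈ L.map f (filter P? xs) → y ∈ filter Q? ys
    onto y∈ with ∈P.∈-map⁻ f y∈
    ... | x , x∈ , refl with ∈P.∈-filter⁻ P? {xs = xs} x∈
    ... | _ , px = ∈P.∈-filter⁺ Q? (Q⊆ys (f-into px)) (f-into px)

vecsOver-suc : {A : Set} (xs : List A) (m : ℕ) →
  vecsOver xs (suc m) ≡ cartesianProductWith _∷_ xs (vecsOver xs m)
vecsOver-suc xs m = go xs
  where
  go : ∀ ys → concatMap (λ y → L.map (y ∷_) (vecsOver xs m)) ys
            ≡ cartesianProductWith _∷_ ys (vecsOver xs m)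
  go []       = refl
  go (y ∷ ys) = cong (L.map (y ∷_) (vecsOver xs m) L.++_) (go ys)

∈-vecsOver⁺ : {A : Set} (xs : List A) {m : ℕ} (v : Vec A m) →
  All (_∈ xs) (toList v) → v ∈ vecsOver xs m
∈-vecsOver⁺ xs []      []         = here refl
∈-vecsOver⁺ xs {suc m} (x ∷ v) (x∈ ∷ v⊆) rewrite vecsOver-suc xs m =
  ∈P.∈-cartesianProductWith⁺ _∷_ x∈ (∈-vecsOver⁺ xs v v⊆)

vecsOver-unique : {A : Set} (xs : List A) → Unique xs → (m : ℕ) → Unique (vecsOver xs m)
vecsOver-unique xs uxs zero    = [] ∷ []
vecsOver-unique xs uxs (suc m) rewrite vecsOver-suc xs m =
  UniqueP.cartesianProductWith⁺ _∷_ VP.∷-injective uxs (vecsOver-unique xs uxs m)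

map-cancel-on : {A B : Set} (f : B → A) (g : A → B) {m : ℕ} (v : Vec A m) →
  All (λ x → f (g x) ≡ x) (toList v) → V.map f (V.map g v) ≡ v
map-cancel-on f g []      []       = refl
map-cancel-on f g (x ∷ v) (fgx ∷ fgv) = cong₂ _∷_ fgx (map-cancel-on f g v fgv)

module _ {P : ℕ → Set} (f : ℕ → ℤ)
         (f-<⇔ : ∀ {a b} → P a → P b → (f b ℤ.< f a) ⇔ (b < a)) where

  -- The head a need not satisfy P; it is compared through x instead of f a, which is
  -- how σ₀ = 0 is matched with σ₁ = s.
  desℤ-map : ∀ {x a} (bs : List ℕ) → (∀ {b} → P b → (f b ℤ.< x) ⇔ (b < a)) →
    All P bs → desℤ (x ∷ L.map f bs) ≡ desℕ (a ∷ bs)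
  desℤ-map []       _   []         = refl
  desℤ-map {x} {a} (b ∷ bs) first-<⇔ (pb ∷ pbs) =
    cong₂ ℕ._+_ (cong (λ c → if c then 1 else 0) (does-⇔ (first-<⇔ pb) (f b ℤP.<? x) (b ℕP.<? a)))
                 (desℤ-map bs (f-<⇔ pb) pbs)

shift-< : ∀ {s x} → x ≤ s → shift (suc s) x ≡ -[1+ s ∸ x ]
shift-< {s} {x} x≤s = begin
  shift (suc s) x      ≡⟨ cong (if_then + x ℤ.- + suc s else + (x ∸ 1)) (dec-true (x <? suc s) (s≤s x≤s)) ⟩
  + x ℤ.- + suc s      ≡⟨ ℤP.m-n≡m⊖n x (suc s) ⟩
  x ℤ.⊖ suc s          ≡⟨ ℤP.⊖-< (s≤s x≤s) ⟩
  ℤ.- + (suc s ∸ x)    ≡⟨ cong (λ t → ℤ.- + t) (ℕP.+-∸-assoc 1 x≤s) ⟩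
  -[1+ s ∸ x ]         ∎
  where open ≡-Reasoning

shift-> : ∀ {s x} → s ≤ x → shift s (suc x) ≡ + x
shift-> {s} {x} s≤x rewrite dec-false (suc x <? s) (ℕP.≤⇒≯ (ℕP.m≤n⇒m≤1+n s≤x)) = refl

below-or-above : ∀ {s x} → s ≢ x → x < s ⊎ s < x
below-or-above {s} {x} s≢x with ℕP.<-cmp x s
... | tri< x<s _ _ = inj₁ x<s
... | tri≈ _ x≡s _ = ⊥-elim (s≢x (sym x≡s))
... | tri> _ _ s<x = inj₂ s<x

shift-mono-< : ∀ {s x y} → s ≢ x → s ≢ y → x < y → shift s x ℤ.< shift s y
shift-mono-< s≢x s≢y x<y with below-or-above s≢x | below-or-above s≢y
... | inj₁ (s≤s x≤s) | inj₁ (s≤s y≤s) rewrite shift-< x≤s | shift-< y≤s =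
  -<- (ℕP.∸-monoʳ-< x<y y≤s)
... | inj₁ (s≤s x≤s) | inj₂ (s≤s s≤y) rewrite shift-< x≤s | shift-> s≤y = -<+
... | inj₂ s<x       | inj₁ y<s       = ⊥-elim (ℕP.<-asym (ℕP.<-trans s<x x<y) y<s)
... | inj₂ (s≤s s≤x) | inj₂ (s≤s s≤y) rewrite shift-> s≤x | shift-> s≤y =
  +<+ (ℕP.≤-pred x<y)

shift-<⇔ : ∀ {s a b} → s ≢ a → s ≢ b → (shift s b ℤ.< shift s a) ⇔ (b < a)
shift-<⇔ {s} {a} {b} s≢a s≢b = mk⇔ reflect (shift-mono-< s≢b s≢a)
  where
  reflect : shift s b ℤ.< shift s a → b < a
  reflect fb<fa with ℕP.<-cmp b a
  ... | tri< b<a _ _  = b<a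
  ... | tri≈ _ refl _ = ⊥-elim (ℤP.<-irrefl refl fb<fa)
  ... | tri> _ _ a<b  = ⊥-elim (ℤP.<-asym fb<fa (shift-mono-< s≢a s≢b a<b))

shift-<0⇔ : ∀ {s b} → s ≢ b → (shift s b ℤ.< 0ℤ) ⇔ (b < s)
shift-<0⇔ s≢b with below-or-above s≢b
... | inj₁ b<s@(s≤s b≤s) rewrite shift-< b≤s = mk⇔ (λ _ → b<s) (λ _ → -<+)
... | inj₂ s<b@(s≤s s≤b) rewrite shift-> s≤b =
  mk⇔ (λ { (+<+ ()) }) (λ b<s → ⊥-elim (ℕP.<-asym b<s s<b))

desℤ-shift : ∀ {s} (bs : List ℕ) → All (s ≢_) bs →
  desℤ (0ℤ ∷ L.map (shift s) bs) ≡ desℕ (s ∷ bs)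
desℤ-shift bs = desℤ-map _ shift-<⇔ bs shift-<0⇔

shift-range : ∀ {n s x} → 1 ≤ s × s ≤ suc n → 1 ≤ x × x ≤ suc n → s ≢ x →
  1 ≤ ∣ shift s x ∣ × ∣ shift s x ∣ ≤ n
shift-range (1≤s , s≤1+n) (1≤x , x≤1+n) s≢x with below-or-above s≢x
... | inj₁ (s≤s x≤s) rewrite shift-< x≤s =
  s≤s z≤n , ℕP.≤-trans (ℕP.∸-monoʳ-< 1≤x x≤s) (ℕP.≤-pred s≤1+n)
... | inj₂ (s≤s s≤x) rewrite shift-> s≤x = ℕP.≤-trans 1≤s s≤x , ℕP.≤-pred x≤1+n

fromAbs : ℕ → ℕ → ℕ
fromAbs s a = if does (a <? s) then s ∸ a else suc a

fromAbs-< : ∀ {s a} → a < s → fromAbs s a ≡ s ∸ a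
fromAbs-< {s} {a} a<s = cong (if_then s ∸ a else suc a) (dec-true (a <? s) a<s)

fromAbs-≥ : ∀ {s a} → s ≤ a → fromAbs s a ≡ suc a
fromAbs-≥ {s} {a} s≤a = cong (if_then s ∸ a else suc a) (dec-false (a <? s) (ℕP.≤⇒≯ s≤a))

fromAbs-∣shift∣ : ∀ {s x} → 1 ≤ x → s ≢ x → fromAbs s ∣ shift s x ∣ ≡ x
fromAbs-∣shift∣ 1≤x s≢x with below-or-above s≢x
... | inj₁ (s≤s x≤s) rewrite shift-< x≤s =
  trans (fromAbs-< (s≤s (ℕP.∸-monoʳ-< 1≤x x≤s))) (ℕP.m∸[m∸n]≡n x≤s)
... | inj₂ (s≤s s≤x) rewrite shift-> s≤x = fromAbs-≥ s≤x

∣shift∣-injective : ∀ {s x y} → 1 ≤ x × s ≢ x → 1 ≤ y × s ≢ y →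
  ∣ shift s x ∣ ≡ ∣ shift s y ∣ → x ≡ y
∣shift∣-injective {s} (1≤x , s≢x) (1≤y , s≢y) eq =
  trans (sym (fromAbs-∣shift∣ 1≤x s≢x)) (trans (cong (fromAbs s) eq) (fromAbs-∣shift∣ 1≤y s≢y))

shift-sign : ∀ {j x} → 1 ≤ x → suc j ≢ x →
  (shift (suc j) x ℤ.< 0ℤ) ⇔ InU j ∣ shift (suc j) x ∣
shift-sign 1≤x s≢x with below-or-above s≢x
... | inj₁ (s≤s x≤j) rewrite shift-< x≤j =
  mk⇔ (λ _ → s≤s z≤n , ℕP.∸-monoʳ-< 1≤x x≤j) (λ _ → -<+)
... | inj₂ (s≤s j<x) rewrite shift-> j<x =
  mk⇔ (λ { (+<+ ()) }) (λ (_ , x≤j) → ⊥-elim (ℕP.<⇒≱ j<x x≤j))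

unshift : ℕ → ℤ → ℕ
unshift s (+ a)    = suc a
unshift s -[1+ a ] = s ∸ suc a

unshift-shift : ∀ {s x} → s ≢ x → unshift s (shift s x) ≡ x
unshift-shift s≢x with below-or-above s≢x
... | inj₁ (s≤s x≤s) rewrite shift-< x≤s = ℕP.m∸[m∸n]≡n x≤s
... | inj₂ (s≤s s≤x) rewrite shift-> s≤x = refl

data SignedEntry (n j : ℕ) : ℤ → Set where
  positive : ∀ {a} → j < a → a ≤ n → SignedEntry n j (+ a)
  negative : ∀ {a} → a < j → SignedEntry n j -[1+ a ]

signedEntry : ∀ {n j t} → 1 ≤ ∣ t ∣ × ∣ t ∣ ≤ n → (t ℤ.< 0ℤ) ⇔ InU j ∣ t ∣ →
  SignedEntry n j t
signedEntry {j = j} {t = + a} (1≤a , a≤n) sign with a ℕP.≤? j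
... | yes a≤j with +<+ () ← Equivalence.from sign (1≤a , a≤j)
... | no  a≰j = positive (ℕP.≰⇒> a≰j) a≤n
signedEntry {t = -[1+ a ]} _ sign = negative (proj₂ (Equivalence.to sign -<+))

shift-unshift : ∀ {n j t} → SignedEntry n j t → shift (suc j) (unshift (suc j) t) ≡ t
shift-unshift (positive j<a _)      = shift-> j<a
shift-unshift {j = j} (negative {a} a<j) =
  trans (shift-< (ℕP.m∸n≤m j a)) (cong -[1+_] (ℕP.m∸[m∸n]≡n (ℕP.<⇒≤ a<j)))

unshift-injective : ∀ {n j t t′} → SignedEntry n j t → SignedEntry n j t′ →
  unshift (suc j) t ≡ unshift (suc j) t′ → t ≡ t′
unshift-injective {j = j} et et′ eq =
  trans (sym (shift-unshift et)) (trans (cong (shift (suc j)) eq) (shift-unshift et′))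

unshift-range : ∀ {n j t} → j ≤ n → SignedEntry n j t →
  (1 ≤ unshift (suc j) t × unshift (suc j) t ≤ suc n) × suc j ≢ unshift (suc j) t
unshift-range j≤n (positive j<a a≤n) =
  (s≤s z≤n , s≤s a≤n) , λ eq → ℕP.<⇒≢ j<a (ℕP.suc-injective eq)
unshift-range {j = j} j≤n (negative {a} a<j) =
  (ℕP.m<n⇒0<n∸m a<j , ℕP.≤-trans (ℕP.m∸n≤m j a) (ℕP.m≤n⇒m≤1+n j≤n)) ,
  λ eq → ℕP.<⇒≢ (s≤s (ℕP.m∸n≤m j a)) (sym eq)

F-desB : ∀ {n s} (r : Vec ℕ n) → All (s ≢_) (toList r) →
  desB (F n (s ∷ r)) ≡ desℕ (toList (s ∷ r))
F-desB {s = s} r s∉r =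
  trans (cong (λ ts → desℤ (0ℤ ∷ ts)) (VP.toList-map (shift s) r)) (desℤ-shift (toList r) s∉r)

F-IsSignedPerm : ∀ {n} (σ : Vec ℕ (suc n)) → IsPerm (suc n) σ → IsSignedPerm n (F n σ)
F-IsSignedPerm (s ∷ r) (s-range ∷ r-range , s∉r ∷ r-unique)
  rewrite VP.toList-map (shift s) r =
    AllP.map⁺ (All.zipWith (λ (x-range , s≢x) → shift-range s-range x-range s≢x) (r-range , s∉r))
  , subst Unique (LP.map-∘ (toList r))
      (Unique-map⁺-on (λ x → ∣ shift s x ∣) ∣shift∣-injective
        (All.zipWith (λ ((1≤x , _) , s≢x) → 1≤x , s≢x) (r-range , s∉r)) r-unique)

F-InB : ∀ n k (σ : Vec ℕ (suc n)) → InA (suc n) k σ → InB n k (F n σ)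
F-InB n k (s ∷ r) (perm@(_ , s∉r ∷ _) , des) =
  F-IsSignedPerm (s ∷ r) perm , trans (F-desB r s∉r) des

F-InBU : ∀ n k j (σ : Vec ℕ (suc n)) → InAj n k (suc j) σ → InBU n k j (F n σ)
F-InBU n k j (s ∷ r) (inA@((_ ∷ r-range , s∉r ∷ _) , _) , refl) =
  F-InB n k (s ∷ r) inA , signs
  where
  signs : All (λ t → (t ℤ.< 0ℤ) ⇔ InU j ∣ t ∣) (toList (V.map (shift s) r))
  signs rewrite VP.toList-map (shift s) r =
    AllP.map⁺ (All.zipWith (λ ((1≤x , _) , s≢x) → shift-sign 1≤x s≢x) (r-range , s∉r))

F-injective : ∀ n k j (σ σ′ : Vec ℕ (suc n)) → InAj n k (suc j) σ → InAj n k (suc j) σ′ →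
  F n σ ≡ F n σ′ → σ ≡ σ′
F-injective n k j (s ∷ r) (s ∷ r′) (((_ , s∉r ∷ _) , _) , refl) (((_ , s∉r′ ∷ _) , _) , refl) eq =
  cong (s ∷_) (begin
    r                                      ≡⟨ sym (map-cancel-on (unshift s) (shift s) r (All.map unshift-shift s∉r)) ⟩
    V.map (unshift s) (V.map (shift s) r)  ≡⟨ cong (V.map (unshift s)) eq ⟩
    V.map (unshift s) (V.map (shift s) r′) ≡⟨ map-cancel-on (unshift s) (shift s) r′ (All.map unshift-shift s∉r′) ⟩
    r′                                     ∎)
  where open ≡-Reasoning

unshift-IsPerm : ∀ {n j} → j ≤ n → (τ : Vec ℤ n) → All (SignedEntry n j) (toList τ) →
  Unique (toList τ) → IsPerm (suc n) (suc j ∷ V.map (unshift (suc j)) τ)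
unshift-IsPerm {n} {j} j≤n τ entries τ-unique = range , unique
  where
  range : All (λ x → 1 ≤ x × x ≤ suc n) (suc j ∷ toList (V.map (unshift (suc j)) τ))
  range rewrite VP.toList-map (unshift (suc j)) τ =
    (s≤s z≤n , s≤s j≤n) ∷ AllP.map⁺ (All.map (λ e → proj₁ (unshift-range j≤n e)) entries)
  unique : Unique (suc j ∷ toList (V.map (unshift (suc j)) τ))
  unique rewrite VP.toList-map (unshift (suc j)) τ =
    AllP.map⁺ (All.map (λ e → proj₂ (unshift-range j≤n e)) entries)
    ∷ Unique-map⁺-on (unshift (suc j)) unshift-injective entries τ-unique

F-surjective : ∀ n k j → j ≤ n → (τ : Vec ℤ n) → InBU n k j τ →
  Σ (Vec ℕ (suc n)) (λ σ → InAj n k (suc j) σ × F n σ ≡ τ)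
F-surjective n k j j≤n τ (((τ-range , τ-unique) , des) , signs) =
  σ , ((perm , desσ) , refl) , Fσ≡τ
  where
  entries : All (SignedEntry n j) (toList τ)
  entries = All.zipWith (λ (range , sign) → signedEntry range sign) (τ-range , signs)
  σ = suc j ∷ V.map (unshift (suc j)) τ
  perm : IsPerm (suc n) σ
  perm = unshift-IsPerm j≤n τ entries (UniqueP.map⁻ τ-unique)
  Fσ≡τ : F n σ ≡ τ
  Fσ≡τ = map-cancel-on (shift (suc j)) (unshift (suc j)) τ (All.map shift-unshift entries)
  desσ : desℕ (toList σ) ≡ k
  desσ with _ , s∉r ∷ _ ← perm =
    trans (sym (F-desB (V.map (unshift (suc j)) τ) s∉r)) (trans (cong desB Fσ≡τ) des)

∈-letters⁺ : ∀ {n x} → 1 ≤ x × x ≤ suc n → x ∈ L.map suc (upTo (suc n))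
∈-letters⁺ (s≤s z≤n , s≤s x≤n) = ∈P.∈-map⁺ suc (∈P.∈-upTo⁺ (s≤s x≤n))

letters-unique : ∀ n → Unique (L.map suc (upTo (suc n)))
letters-unique n = UniqueP.map⁺ ℕP.suc-injective (UniqueP.upTo⁺ (suc n))

∈-intRange⁺ : ∀ {n t} → ∣ t ∣ ≤ n → t ∈ intRange n
∈-intRange⁺ {n} {+ a}      a≤n = ∈P.∈-++⁺ˡ (∈P.∈-map⁺ +_ (∈P.∈-upTo⁺ (s≤s a≤n)))
∈-intRange⁺ {n} { -[1+ a ]} a<n =
  ∈P.∈-++⁺ʳ (L.map +_ (upTo (suc n))) (∈P.∈-map⁺ -[1+_] (∈P.∈-upTo⁺ a<n))

intRange-unique : ∀ n → Unique (intRange n)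
intRange-unique n =
  UniqueP.++⁺ (UniqueP.map⁺ ℤP.+-injective (UniqueP.upTo⁺ (suc n)))
              (UniqueP.map⁺ ℤP.-[1+-injective (UniqueP.upTo⁺ n)) disjoint
  where
  disjoint : ∀ {t} → t ∈ L.map +_ (upTo (suc n)) × t ∈ L.map -[1+_] (upTo n) → ⊥
  disjoint (t∈⁺ , t∈⁻) with ∈P.∈-map⁻ +_ t∈⁺
  ... | _ , _ , refl with ∈P.∈-map⁻ -[1+_] t∈⁻
  ... | _ , _ , ()

b≡aCount : ∀ n k j → j ≤ n → b n k j ≡ aCount n k (suc j)
b≡aCount n k j j≤n =
  length-filter-bijection _ _ _ _
    (vecsOver-unique _ (letters-unique n) (suc n)) (vecsOver-unique _ (intRange-unique n) n)
    (F n) (F-injective n k j _ _) (F-InBU n k j _) (F-surjective n k j j≤n _)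
    (λ (((range , _) , _) , _) → ∈-vecsOver⁺ _ _ (All.map ∈-letters⁺ range))
    (λ (((range , _) , _) , _) → ∈-vecsOver⁺ _ _ (All.map (λ r → ∈-intRange⁺ (proj₂ r)) range))

theorem5p1 : (n j k : ℕ) → j ≤ n → k ≤ n →
    ((σ : Vec ℕ (suc n)) → InA (suc n) k σ → InB n k (F n σ))
  × ((σ : Vec ℕ (suc n)) → InAj n k (suc j) σ → InBU n k j (F n σ))
  × ((σ σ′ : Vec ℕ (suc n)) → InAj n k (suc j) σ → InAj n k (suc j) σ′ →
       F n σ ≡ F n σ′ → σ ≡ σ′)
  × ((τ : Vec ℤ n) → InBU n k j τ →
       Σ (Vec ℕ (suc n)) (λ σ → InAj n k (suc j) σ × F n σ ≡ τ))
  × (b n k j ≡ aCount n k (suc j))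
theorem5p1 n j k j≤n _ =
  F-InB n k , F-InBU n k j , F-injective n k j , F-surjective n k j j≤n , b≡aCount n k j j≤n
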